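{- Let $G$ be a finite simple graph that is vertex-critical for Property $(\star)$. Then $G$ has no trivial homogeneous pair of cliques.
   Context: Property $(\star)$ for a graph $G$ means $\chi(G) > \Delta_2(G)+3$, where $\Delta_2(G)$ is the maximum, over distinct vertices $u,v$, of the number of common neighbors of $u$ and $v$. $G$ is vertex-critical for Property $(\star)$ if $G$ satisfies Property $(\star)$ but no proper induced subgraph of $G$ does. A homogeneous pair of cliques in $G$ is a pair $(A,B)$ such that $A$ and $B$ are cliques of $G$, every vertex $v\in V(G)\setminus(A\cup B)$ is either complete or anticomplete to $A$ and is either complete or anticomplete to $B$, and $|A|+|B|\ge 3$. It is non-trivial if the subgraph induced by $A\cup B$ contains an induced $4$-cycle, and trivial otherwise. -}

module Defs where

open import Data.Nat using (ℕ; zero; suc; _+_; _<_; _≤_; _⊔_)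
open import Data.Bool using (Bool; true; false; T; _∧_; if_then_else_)
open import Data.Fin using (Fin)
open import Data.Fin.Subset using (Subset; _∈_; _∉_; _∪_; ∣_∣)
open import Data.List using (List; length; filterᵇ; allFin; foldr; map; concatMap)
open import Data.Product using (Σ; _×_; ∃; ∃-syntax)
open import Data.Sum using (_⊎_)
open import Relation.Nullary using (¬_; does)
open import Relation.Binary.PropositionalEquality using (_≡_; _≢_)
open import Function.Definitions using (Injective)
import Data.Fin as F

record Graph (n : ℕ) : Set where
  field
    adj     : Fin n → Fin n → Bool
    sym     : ∀ u v → adj u v ≡ adj v u
    irrefl  : ∀ v → adj v v ≡ false
open Graph public

Adj : ∀ {n} → Graph n → Fin n → Fin n → Set
Adj G u v = T (adj G u v)

induced : ∀ {m n} (G : Graph n) (f : Fin m → Fin n) → Injective _≡_ _≡_ f → Graph m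
induced G f inj = record
  { adj    = λ i j → adj G (f i) (f j)
  ; sym    = λ i j → sym G (f i) (f j)
  ; irrefl = λ i → irrefl G (f i)
  }

Colourable : ∀ {n} → Graph n → ℕ → Set
Colourable {n} G k = Σ (Fin n → Fin k) λ c → ∀ u v → Adj G u v → c u ≢ c v

IsChromaticNumber : ∀ {n} → Graph n → ℕ → Set
IsChromaticNumber G k = Colourable G k × (∀ j → j < k → ¬ Colourable G j)

commonNbrs : ∀ {n} → Graph n → Fin n → Fin n → ℕ
commonNbrs {n} G u v = length (filterᵇ (λ w → adj G u w ∧ adj G v w) (allFin n))

-- Δ₂(G): maximum over distinct u, v of the number of common neighbours
-- (0 if G has fewer than two vertices).
Δ₂ : ∀ {n} → Graph n → ℕ
Δ₂ {n} G = foldr _⊔_ 0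
  (concatMap (λ u → map (λ v → if does (u F.≟ v) then 0 else commonNbrs G u v) (allFin n))
             (allFin n))

Star : ∀ {n} → Graph n → Set
Star G = ∃[ k ] (IsChromaticNumber G k × Δ₂ G + 3 < k)

-- G is vertex-critical for (⋆): G has (⋆) and no proper induced subgraph does.
-- A proper induced subgraph is the subgraph induced on the image of an
-- injective map Fin m → Fin n with m < n.
VertexCritical : ∀ {n} → Graph n → Set
VertexCritical {n} G =
  Star G ×
  (∀ m (f : Fin m → Fin n) (inj : Injective _≡_ _≡_ f) → m < n → ¬ Star (induced G f inj))

IsClique : ∀ {n} → Graph n → Subset n → Set
IsClique G A = ∀ u v → u ∈ A → v ∈ A → u ≢ v → Adj G u v

CompleteTo : ∀ {n} → Graph n → Fin n → Subset n → Set
CompleteTo G v A = ∀ a → a ∈ A → Adj G v a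

AnticompleteTo : ∀ {n} → Graph n → Fin n → Subset n → Set
AnticompleteTo G v A = ∀ a → a ∈ A → ¬ Adj G v a

IsHomogeneousPairOfCliques : ∀ {n} → Graph n → Subset n → Subset n → Set
IsHomogeneousPairOfCliques G A B =
  IsClique G A × IsClique G B ×
  (∀ v → v ∉ (A ∪ B) →
     (CompleteTo G v A ⊎ AnticompleteTo G v A) ×
     (CompleteTo G v B ⊎ AnticompleteTo G v B)) ×
  3 ≤ ∣ A ∣ + ∣ B ∣

HasInducedC4In : ∀ {n} → Graph n → Subset n → Set
HasInducedC4In {n} G S = Σ (Fin n) λ a → Σ (Fin n) λ b → Σ (Fin n) λ c → Σ (Fin n) λ d →
  (a ∈ S × b ∈ S × c ∈ S × d ∈ S) ×
  (a ≢ b × a ≢ c × a ≢ d × b ≢ c × b ≢ d × c ≢ d) ×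
  (Adj G a b × Adj G b c × Adj G c d × Adj G d a) ×
  (¬ Adj G a c × ¬ Adj G b d)

IsTrivialHomogeneousPairOfCliques : ∀ {n} → Graph n → Subset n → Subset n → Set
IsTrivialHomogeneousPairOfCliques G A B =
  IsHomogeneousPairOfCliques G A B × ¬ HasInducedC4In G (A ∪ B)

{-# OPTIONS --safe #-}
-- Call a vertex b dominated by a ≢ b when N(b) ∖ {a} ⊆ N(a). A vertex-critical graph G has no
-- dominated vertex: deleting b does not increase Δ₂, and every colouring of G − b with at least
-- Δ₂(G) + 2 colours extends to b, because the neighbours of b are a and common neighbours of a
-- and b. So G − b keeps χ = χ(G) > Δ₂(G) + 3 ≥ Δ₂(G − b) + 3, contradicting criticality.
-- Now let a ≢ b lie in one clique X of a homogeneous pair (X , Y). A witness x against "a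
-- dominates b" (x ~ b, x ≁ a) is outside X and, by homogeneity, inside Y; likewise a witness y
-- against "b dominates a". Then a-b-x-y-a is an induced 4-cycle in X ∪ Y. Hence both cliques of a
-- trivial pair have at most one vertex, contradicting |A| + |B| ≥ 3.
module Submission where

open import Defs hiding (sym)
open import Data.Nat using (zero; suc; _+_; _≤_; _<_; _⊔_; z≤n; s≤s)
open import Data.Nat.Properties
  using (≤-refl; ≤-trans; <-trans; ≤-<-trans; <-≤-trans; <⇒≱; n≤1+n; n<1+n; +-comm;
         +-monoˡ-≤; +-monoʳ-<; ⊔-lub; m≤m⊔n; m≤n⊔m)
open import Data.Bool using (Bool; T; _∧_; if_then_else_)
open import Data.Bool.Properties using (T-∧)
open import Data.Empty using (⊥-elim)
open import Data.Fin as Fin using (Fin; punchIn; punchOut; inject≤)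
open import Data.Fin.Properties
  using (suc-injective; punchIn-injective; punchIn-punchOut; punchInᵢ≢i; inject≤-injective;
         injective⇒≤; ¬∀⟶∃¬; any?)
open import Data.Fin.Subset using (Subset; Nonempty; inside; outside; _∈_; _∉_; _∪_; ∣_∣)
open import Data.Fin.Subset.Properties using (x∈p∪q⁺; x∈p∪q⁻; ∪-comm) renaming (_∈?_ to _∈ₛ?_)
open import Data.List using (List; _∷_; length; lookup; map; filterᵇ; allFin; tabulate)
open import Data.List.Properties using (length-map; foldr-preservesᵇ; foldr-preservesᵒ)
open import Data.List.Membership.Propositional using () renaming (_∈_ to _∈ₗ_; _∉_ to _∉ₗ_)
open import Data.List.Membership.Propositional.Properties using (∈-map⁺; ∈-filter⁺; ∈-allFin)
open import Data.List.Relation.Unary.Any as Any using (here; there)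
import Data.List.Relation.Unary.Any.Properties as Anyₚ
import Data.List.Relation.Unary.All.Properties as Allₚ
open import Data.List.Relation.Binary.Pointwise using (tabulate⁺)
open import Data.List.Relation.Binary.Sublist.Heterogeneous using (Sublist; _∷_; _∷ʳ_)
open import Data.List.Relation.Binary.Sublist.Heterogeneous.Properties
  using (fromPointwise; length-mono-≤; ⊆-filter-Sublist)
open import Data.Product using (_×_; _,_; proj₁; proj₂; ∃; ∃₂)
open import Data.Sum using (_⊎_; inj₁; inj₂; [_,_]′)
open import Data.Vec using (here; there) renaming (_∷_ to _∷ᵥ_)
open import Data.Vec.Functional using (insertAt)
open import Data.Vec.Functional.Properties using (insertAt-lookup; insertAt-punchIn)
open import Function using (_∘_; id; Equivalence)
open import Function.Definitions using (Injective)
open import Relation.Nullary using (¬_; yes; no; does)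
open import Relation.Nullary.Decidable using (T?; ¬?; _×-dec_; decidable-stable)
open import Relation.Binary.PropositionalEquality using (_≡_; _≢_; refl; sym; trans; subst)

length<⇒∃∉ : ∀ {k} (cs : List (Fin k)) → length cs < k → ∃ (_∉ₗ cs)
length<⇒∃∉ {k} cs |cs|<k =
  ¬∀⟶∃¬ k (_∈ₗ cs) (λ c → Any.any? (c Fin.≟_) cs)
    (λ all∈ → <⇒≱ |cs|<k (injective⇒≤ (index-injective all∈)))
  where
  index-injective : (all∈ : ∀ c → c ∈ₗ cs) → Injective _≡_ _≡_ (Any.index ∘ all∈)
  index-injective all∈ {c} {c′} eq = trans (Anyₚ.lookup-index (all∈ c))
    (subst (λ i → lookup cs i ≡ c′) (sym eq) (sym (Anyₚ.lookup-index (all∈ c′))))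

punchIn-Sublist : ∀ {A B : Set} {R : A → B → Set} {m} (i : Fin (suc m))
                  {g : Fin m → A} {f : Fin (suc m) → B} →
                  (∀ x → R (g x) (f (punchIn i x))) → Sublist R (tabulate g) (tabulate f)
punchIn-Sublist Fin.zero r = _ ∷ʳ fromPointwise (tabulate⁺ r)
punchIn-Sublist {m = suc m} (Fin.suc i) {g} {f} r =
  r Fin.zero ∷ punchIn-Sublist i {g ∘ Fin.suc} {f ∘ Fin.suc} (r ∘ Fin.suc)

length-filterᵇ-punchIn : ∀ {m} (i : Fin (suc m)) (q : Fin (suc m) → Bool) →
  length (filterᵇ (q ∘ punchIn i) (allFin m)) ≤ length (filterᵇ q (allFin (suc m)))
length-filterᵇ-punchIn i q = length-mono-≤
  (⊆-filter-Sublist (T? ∘ q ∘ punchIn i) (T? ∘ q) (λ { refl → id })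
    (punchIn-Sublist {R = λ x y → punchIn i x ≡ y} i {id} {id} (λ _ → refl)))

module _ {n} (G : Graph n) where

  Δ₂-lub : ∀ {M} → (∀ u v → u ≢ v → commonNbrs G u v ≤ M) → Δ₂ G ≤ M
  Δ₂-lub {M} bound = foldr-preservesᵇ {P = _≤ M} ⊔-lub z≤n
    (Allₚ.concat⁺ (Allₚ.map⁺ (Allₚ.tabulate⁺ λ u → Allₚ.map⁺ (Allₚ.tabulate⁺ (entry≤ u)))))
    where
    entry≤ : ∀ u v → (if does (u Fin.≟ v) then 0 else commonNbrs G u v) ≤ M
    entry≤ u v with u Fin.≟ v
    ... | yes _   = z≤n
    ... | no  u≢v = bound u v u≢v

  commonNbrs≤Δ₂ : ∀ {u v} → u ≢ v → commonNbrs G u v ≤ Δ₂ G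
  commonNbrs≤Δ₂ {u} {v} u≢v = foldr-preservesᵒ {P = commonNbrs G u v ≤_} max≥ 0 _
    (inj₂ (Anyₚ.concat⁺ (Anyₚ.map⁺ (Anyₚ.tabulate⁺ u (Anyₚ.map⁺ (Anyₚ.tabulate⁺ v entry≥))))))
    where
    max≥ : ∀ x y → commonNbrs G u v ≤ x ⊎ commonNbrs G u v ≤ y → commonNbrs G u v ≤ x ⊔ y
    max≥ x y = [ (λ c≤x → ≤-trans c≤x (m≤m⊔n x y)) , (λ c≤y → ≤-trans c≤y (m≤n⊔m x y)) ]′

    entry≥ : commonNbrs G u v ≤ (if does (u Fin.≟ v) then 0 else commonNbrs G u v)
    entry≥ with u Fin.≟ v
    ... | yes u≡v = ⊥-elim (u≢v u≡v)
    ... | no  _   = ≤-refl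

  Colourable-mono : ∀ {j k} → j ≤ k → Colourable G j → Colourable G k
  Colourable-mono j≤k (c , proper) =
    (λ v → inject≤ (c v) j≤k) , λ u v uv → proper u v uv ∘ inject≤-injective j≤k j≤k (c u) (c v)

  Colourable-induced : ∀ {m k} (f : Fin m → Fin n) (inj : Injective _≡_ _≡_ f) →
                       Colourable G k → Colourable (induced G f inj) k
  Colourable-induced f inj (c , proper) = c ∘ f , λ u v → proper (f u) (f v)

≡⊎punchIn : ∀ {m} (i w : Fin (suc m)) → w ≡ i ⊎ ∃ λ w′ → punchIn i w′ ≡ w
≡⊎punchIn i w with w Fin.≟ i
... | yes w≡i = inj₁ w≡i
... | no  w≢i = inj₂ (punchOut (w≢i ∘ sym) , punchIn-punchOut (w≢i ∘ sym))

deleteVertex : ∀ {m} → Graph (suc m) → Fin (suc m) → Graph m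
deleteVertex G v = induced G (punchIn v) (punchIn-injective v _ _)

module _ {m} (G : Graph (suc m)) (v : Fin (suc m)) where

  Δ₂-deleteVertex : Δ₂ (deleteVertex G v) ≤ Δ₂ G
  Δ₂-deleteVertex = Δ₂-lub (deleteVertex G v) λ x y x≢y →
    ≤-trans (length-filterᵇ-punchIn v (λ w → adj G (punchIn v x) w ∧ adj G (punchIn v y) w))
            (commonNbrs≤Δ₂ G (x≢y ∘ punchIn-injective v x y))

  Colourable-extend : ∀ {j} (ns : List (Fin m)) → (∀ w → Adj G v (punchIn v w) → w ∈ₗ ns) →
                      length ns < j → Colourable (deleteVertex G v) j → Colourable G j
  Colourable-extend {j} ns covers |ns|<j (c , proper) = insertAt c v col , proper′
    where
    free : ∃ (_∉ₗ map c ns)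
    free = length<⇒∃∉ (map c ns) (subst (_< j) (sym (length-map c ns)) |ns|<j)

    col : Fin j
    col = proj₁ free

    fresh : ∀ w → Adj G v (punchIn v w) → col ≢ c w
    fresh w vw col≡cw = proj₂ free (subst (_∈ₗ map c ns) (sym col≡cw) (∈-map⁺ c (covers w vw)))

    proper′ : ∀ x y → Adj G x y → insertAt c v col x ≢ insertAt c v col y
    proper′ x y xy with ≡⊎punchIn v x | ≡⊎punchIn v y
    ... | inj₁ refl | inj₁ refl = ⊥-elim (subst T (irrefl G v) xy)
    ... | inj₁ refl | inj₂ (y′ , refl)
      rewrite insertAt-lookup c v col | insertAt-punchIn c v col y′ = fresh y′ xy
    ... | inj₂ (x′ , refl) | inj₁ refl
      rewrite insertAt-lookup c v col | insertAt-punchIn c v col x′ =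
        fresh x′ (subst T (Graph.sym G x v) xy) ∘ sym
    ... | inj₂ (x′ , refl) | inj₂ (y′ , refl)
      rewrite insertAt-punchIn c v col x′ | insertAt-punchIn c v col y′ = proper x′ y′ xy

Dominates : ∀ {n} → Graph n → Fin n → Fin n → Set
Dominates G a b = ∀ w → w ≢ a → Adj G b w → Adj G a w

module _ {m} (G : Graph (suc m)) (v : Fin (suc m)) (u : Fin m)
         (dom : Dominates G (punchIn v u) v) where

  Colourable-extend-dominated : ∀ {j} → suc (Δ₂ G) < j →
                                Colourable (deleteVertex G v) j → Colourable G j
  Colourable-extend-dominated {j} 1+Δ₂<j = Colourable-extend G v (u ∷ common) covers |u∷common|<j
    where
    q : Fin (suc m) → Bool
    q w = adj G (punchIn v u) w ∧ adj G v w

    common : List (Fin m)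
    common = filterᵇ (q ∘ punchIn v) (allFin m)

    covers : ∀ w → Adj G v (punchIn v w) → w ∈ₗ u ∷ common
    covers w vw with w Fin.≟ u
    ... | yes w≡u = here w≡u
    ... | no  w≢u = there (∈-filter⁺ (T? ∘ q ∘ punchIn v) (∈-allFin w)
            (Equivalence.from T-∧ (dom (punchIn v w) (w≢u ∘ punchIn-injective v w u) vw , vw)))

    |u∷common|<j : suc (length common) < j
    |u∷common|<j = ≤-<-trans
      (s≤s (≤-trans (length-filterᵇ-punchIn v q) (commonNbrs≤Δ₂ G (punchInᵢ≢i v u)))) 1+Δ₂<j

  Star-deleteDominated : Star G → Star (deleteVertex G v)
  Star-deleteDominated (k , (colG , minG) , Δ₂+3<k) =
    k , (Colourable-induced G (punchIn v) (punchIn-injective v _ _) colG , minH) ,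
    ≤-<-trans (+-monoˡ-≤ 3 (Δ₂-deleteVertex G v)) Δ₂+3<k
    where
    2+Δ₂<k : 2 + Δ₂ G < k
    2+Δ₂<k = subst (_< k) (+-comm (Δ₂ G) 2) (<-trans (+-monoʳ-< (Δ₂ G) (n<1+n 2)) Δ₂+3<k)

    minH : ∀ j → j < k → ¬ Colourable (deleteVertex G v) j
    minH j j<k colH = minG (j ⊔ (2 + Δ₂ G)) j⊔[2+Δ₂]<k
      (Colourable-extend-dominated (<-≤-trans (n<1+n _) (m≤n⊔m j _))
        (Colourable-mono (deleteVertex G v) (m≤m⊔n j _) colH))
      where
      j⊔[2+Δ₂]<k : suc j ⊔ suc (2 + Δ₂ G) ≤ k
      j⊔[2+Δ₂]<k = ⊔-lub j<k 2+Δ₂<k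

VertexCritical⇒¬Dominates : ∀ {n} (G : Graph n) {a b : Fin n} →
                            VertexCritical G → a ≢ b → ¬ Dominates G a b
VertexCritical⇒¬Dominates {zero} _ {a = ()}
VertexCritical⇒¬Dominates {suc m} G {a} {b} (star , critical) a≢b dom with ≡⊎punchIn b a
... | inj₁ a≡b = a≢b a≡b
... | inj₂ (u , refl) =
  critical m (punchIn b) (punchIn-injective b _ _) (n<1+n m) (Star-deleteDominated G b u dom star)

¬Dominates⇒witness : ∀ {n} (G : Graph n) {a b : Fin n} →
  ¬ Dominates G a b → ∃ λ w → w ≢ a × Adj G b w × ¬ Adj G a w
¬Dominates⇒witness G {a} {b} ¬dom
  with any? (λ w → ¬? (w Fin.≟ a) ×-dec T? (adj G b w) ×-dec ¬? (T? (adj G a w)))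
... | yes witness = witness
... | no  ¬witness = ⊥-elim (¬dom λ w w≢a bw →
        decidable-stable (T? (adj G a w)) λ ¬aw → ¬witness (w , w≢a , bw , ¬aw))

∈≢∉ : ∀ {n} {S : Subset n} {x y} → x ∈ S → y ∉ S → x ≢ y
∈≢∉ xS y∉S refl = y∉S xS

0<∣p∣⇒Nonempty : ∀ {n} {p : Subset n} → 0 < ∣ p ∣ → Nonempty p
0<∣p∣⇒Nonempty {p = inside  ∷ᵥ p} _      = Fin.zero , here
0<∣p∣⇒Nonempty {p = outside ∷ᵥ p} 0<∣p∣ with (x , x∈p) ← 0<∣p∣⇒Nonempty 0<∣p∣ =
  Fin.suc x , there x∈p

1<∣p∣⇒distinct : ∀ {n} {p : Subset n} → 1 < ∣ p ∣ → ∃₂ λ x y → x ≢ y × x ∈ p × y ∈ p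
1<∣p∣⇒distinct {p = inside ∷ᵥ p} (s≤s 0<∣p∣) with (y , y∈p) ← 0<∣p∣⇒Nonempty 0<∣p∣ =
  Fin.zero , Fin.suc y , (λ ()) , here , there y∈p
1<∣p∣⇒distinct {p = outside ∷ᵥ p} 1<∣p∣ with (x , y , x≢y , x∈p , y∈p) ← 1<∣p∣⇒distinct 1<∣p∣ =
  Fin.suc x , Fin.suc y , x≢y ∘ suc-injective , there x∈p , there y∈p

module _ {n} {G : Graph n} {X Y : Subset n} (X-clique : IsClique G X) (Y-clique : IsClique G Y)
         (X-homogeneous : ∀ v → v ∉ X ∪ Y → CompleteTo G v X ⊎ AnticompleteTo G v X) where

  private
    separating∉X : ∀ {a x} → a ∈ X → x ≢ a → ¬ Adj G a x → x ∉ X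
    separating∉X aX x≢a ¬ax xX = ¬ax (X-clique _ _ aX xX (x≢a ∘ sym))

    separating∈Y : ∀ {a b x} → a ∈ X → b ∈ X → x ≢ a → Adj G b x → ¬ Adj G a x → x ∈ Y
    separating∈Y {a} {b} {x} aX bX x≢a bx ¬ax = decidable-stable (x ∈ₛ? Y) λ x∉Y →
      [ (λ complete → ¬ax (subst T (Graph.sym G x a) (complete a aX)))
      , (λ anticomplete → anticomplete b bX (subst T (Graph.sym G b x) bx))
      ]′ (X-homogeneous x ([ separating∉X aX x≢a ¬ax , x∉Y ]′ ∘ x∈p∪q⁻ X Y))

  mutuallyNonDominating⇒C4 : ∀ {a b} → a ∈ X → b ∈ X → a ≢ b →
    ¬ Dominates G a b → ¬ Dominates G b a → HasInducedC4In G (X ∪ Y)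
  mutuallyNonDominating⇒C4 {a} {b} aX bX a≢b ¬ab ¬ba
    with (x , x≢a , bx , ¬ax) ← ¬Dominates⇒witness G ¬ab
       | (y , y≢b , ay , ¬by) ← ¬Dominates⇒witness G ¬ba
    = a , b , x , y
    , (x∈p∪q⁺ (inj₁ aX) , x∈p∪q⁺ (inj₁ bX) , x∈p∪q⁺ (inj₂ xY) , x∈p∪q⁺ (inj₂ yY))
    , (a≢b , ∈≢∉ aX x∉X , ∈≢∉ aX y∉X , ∈≢∉ bX x∉X , ∈≢∉ bX y∉X , x≢y)
    , (X-clique a b aX bX a≢b , bx , Y-clique x y xY yY x≢y , subst T (Graph.sym G a y) ay)
    , (¬ax , ¬by)
    where
    x∉X : x ∉ X
    x∉X = separating∉X aX x≢a ¬ax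

    y∉X : y ∉ X
    y∉X = separating∉X bX y≢b ¬by

    xY : x ∈ Y
    xY = separating∈Y aX bX x≢a bx ¬ax

    yY : y ∈ Y
    yY = separating∈Y bX aX y≢b ay ¬by

    x≢y : x ≢ y
    x≢y refl = ¬by bx

VertexCritical⇒trivialPair-∣X∣≤1 : ∀ {n} (G : Graph n) {X Y : Subset n} → VertexCritical G →
  IsClique G X → IsClique G Y → (∀ v → v ∉ X ∪ Y → CompleteTo G v X ⊎ AnticompleteTo G v X) →
  ¬ HasInducedC4In G (X ∪ Y) → ¬ 1 < ∣ X ∣
VertexCritical⇒trivialPair-∣X∣≤1 G critical X-clique Y-clique X-homogeneous noC4 1<∣X∣
  with (a , b , a≢b , aX , bX) ← 1<∣p∣⇒distinct 1<∣X∣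
  = noC4 (mutuallyNonDominating⇒C4 {G = G} X-clique Y-clique X-homogeneous aX bX a≢b
           (VertexCritical⇒¬Dominates G critical a≢b)
           (VertexCritical⇒¬Dominates G critical (a≢b ∘ sym)))

1<m⊎1<n : ∀ m {n} → 3 ≤ m + n → 1 < m ⊎ 1 < n
1<m⊎1<n zero          3≤n       = inj₂ (≤-trans (n≤1+n 2) 3≤n)
1<m⊎1<n (suc zero)    (s≤s 2≤n) = inj₂ 2≤n
1<m⊎1<n (suc (suc m)) _         = inj₁ (s≤s (s≤s z≤n))

lemma3p3 : ∀ {n} (G : Graph n) → VertexCritical G →
    ∀ (A B : Subset n) → ¬ IsTrivialHomogeneousPairOfCliques G A B
lemma3p3 G critical A B ((A-clique , B-clique , homogeneous , 3≤∣A∣+∣B∣) , noC4) =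
  [ VertexCritical⇒trivialPair-∣X∣≤1 G critical A-clique B-clique (λ v → proj₁ ∘ homogeneous v) noC4
  , VertexCritical⇒trivialPair-∣X∣≤1 G critical B-clique A-clique
      (λ v → proj₂ ∘ homogeneous v ∘ subst (v ∉_) (∪-comm B A))
      (noC4 ∘ subst (HasInducedC4In G) (∪-comm B A))
  ]′ (1<m⊎1<n ∣ A ∣ 3≤∣A∣+∣B∣)
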